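{- Let $(i,j)$ be a live entry of a scroll, followed (in the ticker-tape reading order) by a $0$-block of length $z$. Then the subslither from $(i,j)$ is $E$ if $z=1$, and is $DE^{\lfloor z/2\rfloor-1}D$ if $z\in\{2,\dots,n\}$.
   Context: Let $n\ge2$ and $\mathcal{C}_n$ the cycle graph on $\mathbb{Z}_n=\{1,\dots,n\}$ with edges $\{i,i+1\}$ (mod $n$). Independent sets are binary vectors $x\in\{0,1\}^n$ with no two cyclically adjacent $1$s. The toggle $\tau_k$ changes $x_k$ from $1$ to $0$, from $0$ to $1$ if the result is independent, otherwise does nothing; $\tau=\tau_n\circ\cdots\circ\tau_1$, $x^{(i)}=\tau^i(x)$ for $i\in\mathbb{Z}$. The scroll is the array $X_{i,j}$ ($i\in\mathbb{Z}$, $j\in\{1,\dots,n\}$) with row $i$ equal to $x^{(i)}$, with convention $X_{i,j+n}=X_{i+1,j}$; reading rows left to right, top to bottom gives a bi-infinite sequence (the ticker tape). Live entries are positions with value $1$. For a live entry $u$, its next live entry $u^+$ is the first live entry after $u$ in this reading order; the $0$-block following $u$ is the maximal run of $0$s between $u$ and $u^+$. The successor $s$ sends a live $(i,j)$ to the unique live element of $\{(i,j+2),(i+1,j+1)\}$; the co-successor $c$ sends it to the unique live element of $\{(i+2,j-2),(i+2,j-1)\}$. A step $(i,j)\to s(i,j)$ has type $E$ if $s(i,j)=(i,j+2)$ and type $D$ if $s(i,j)=(i+1,j+1)$. The subslither from a live $u$ followed by a $0$-block of length $z$ is the word $E$ if $z=1$, and otherwise is the word of step types of the shortest path $u\to s(u)\to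 s^2(u)\to\cdots$ ending at $c(u^+)$. -}

module Defs where

open import Data.Bool using (Bool; true; false; _∧_; not; if_then_else_)
open import Data.Nat as ℕ using (ℕ; NonZero; _%_)
open import Data.Nat.DivMod using (m%n<n)
open import Data.Fin using (Fin; toℕ; fromℕ<; _≟_)
open import Data.Fin.Properties using (all?)
open import Data.List using (List; []; _∷_; _++_; foldl; foldr; allFin)
open import Data.Integer as ℤ using (ℤ; +_; -[1+_]; _/ℕ_; _%ℕ_)
open import Data.Product using (Σ; ∃; _×_)
open import Data.Sum using (_⊎_)
open import Function using (_∘_)
open import Relation.Nullary using (¬_; does)
open import Relation.Binary.PropositionalEquality using (_≡_; _≢_)
open import Data.Bool using () renaming (_≟_ to _≟B_)

-- Cycle graph C_n on vertices {1,…,n}; internally vertex j ∈ {1..n}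
-- is represented by the 0-based index j-1 : Fin n.
-- A configuration is a binary vector x ∈ {0,1}^n, i.e. Fin n → Bool.

data Letter : Set where
  E D : Letter

other : Letter → Letter
other E = D
other D = E

Config : ℕ → Set
Config n = Fin n → Bool

module _ {n : ℕ} {{_ : NonZero n}} where

  at : Config n → ℕ → Bool
  at x k = x (fromℕ< (m%n<n k n))

  Independent : Config n → Set
  Independent x = (i : Fin n) → (x i ∧ at x (ℕ.suc (toℕ i))) ≡ false

  independent? : (x : Config n) → Relation.Nullary.Dec (Independent x)
  independent? x = all? (λ i → (x i ∧ at x (ℕ.suc (toℕ i))) ≟B false)

  set : Config n → Fin n → Bool → Config n
  set x k b j = if does (j ≟ k) then b else x j

  toggle : Fin n → Config n → Config n
  toggle k x =
    if x k then set x k false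
    else (if does (independent? (set x k true)) then set x k true else x)

  τ : Config n → Config n
  τ x = foldl (λ y k → toggle k y) x (allFin n)

  -- τ⁻¹ = τ_1 ∘ ⋯ ∘ τ_n  (the inverse of τ on independent sets,
  -- since each toggle is an involution on independent sets)
  τ⁻¹ : Config n → Config n
  τ⁻¹ x = foldr toggle x (allFin n)

  iter : ℕ → (Config n → Config n) → Config n → Config n
  iter ℕ.zero    f x = x
  iter (ℕ.suc k) f x = f (iter k f x)

  τ^ : ℤ → Config n → Config n
  τ^ (+ k)      = iter k τ
  τ^ -[1+ k ]   = iter (ℕ.suc k) τ⁻¹

  -- Entry (i,j) of the scroll (i ∈ ℤ, j ∈ {1..n}) sits at
  -- tape position i*n + (j-1).  The convention X_{i,j+n} = X_{i+1,j}
  -- is built in: every p ∈ ℤ is a tape position, read in row ⌊p/n⌋,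
  -- column (p mod n)+1.

  pos : ℤ → Fin n → ℤ
  pos i j = i ℤ.* + n ℤ.+ + toℕ j

  tape : Config n → ℤ → Bool
  tape x p = at (τ^ (p /ℕ n) x) (p %ℕ n)

  Live : Config n → ℤ → Set
  Live x p = tape x p ≡ true

  ZeroBlock : Config n → ℤ → ℕ → Set
  ZeroBlock x u z =
    Live x u × Live x (u ℤ.+ + ℕ.suc z) ×
    ((k : ℕ) → 1 ℕ.≤ k → k ℕ.≤ z → tape x (u ℤ.+ + k) ≡ false)

  -- Step types.  E : (i,j) → (i,j+2)  (tape +2);
  --              D : (i,j) → (i+1,j+1) (tape +(n+1)).

  δ : Letter → ℤ
  δ E = + 2
  δ D = + (ℕ.suc n)

  SuccStep : Config n → ℤ → Letter → Set
  SuccStep x p l = Live x (p ℤ.+ δ l) × ¬ Live x (p ℤ.+ δ (other l))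

  -- c(p) = q : q is the unique live element of {(i+2,j-2),(i+2,j-1)},
  -- i.e. of tape positions {p+2n-2, p+2n-1}
  CoSucc : Config n → ℤ → ℤ → Set
  CoSucc x p q =
    (q ≡ p ℤ.+ + (2 ℕ.* n ℕ.∸ 2) × Live x q × ¬ Live x (p ℤ.+ + (2 ℕ.* n ℕ.∸ 1)))
    ⊎ (q ≡ p ℤ.+ + (2 ℕ.* n ℕ.∸ 1) × Live x q × ¬ Live x (p ℤ.+ + (2 ℕ.* n ℕ.∸ 2)))

  data Path (x : Config n) : ℤ → List Letter → ℤ → Set where
    done : ∀ {p} → Path x p [] p
    step : ∀ {p l w q} → SuccStep x p l → Path x (p ℤ.+ δ l) w q →
           Path x p (l ∷ w) q

  ShortestPath : Config n → ℤ → List Letter → ℤ → Set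
  ShortestPath x p w q =
    Path x p w q ×
    ((w′ v : List Letter) → w′ ++ v ≡ w → Path x p w′ q → v ≡ [])

  Subslither : Config n → ℤ → List Letter → Set
  Subslither x u w =
    Σ ℕ λ z → ZeroBlock x u z ×
      (z ≡ 1 → w ≡ E ∷ []) ×
      (z ≢ 1 → ∃ λ q → CoSucc x (u ℤ.+ + ℕ.suc z) q × ShortestPath x u w q)

-- A sweep τ = τₙ ∘ ⋯ ∘ τ₁ toggles column j when its left neighbour already
-- carries the new row and its right neighbour still the old one.  On the ticker
-- tape both are plain tape neighbours, so every entry obeys the local rule
--   X (p + n) = NOR (X p , X (p + n − 1) , X (p + 1)),
-- row boundaries included.  Feeding a live entry u, its block of z ≥ 2 zeros and
-- the next live entry into this rule, the row below u reads 0 1 0 1 … under the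
-- block, and two rows below the entries from u + 2n on are dead up to the live
-- entry u + 2n + 2⌊z/2⌋.  So the successors of u go down (D), right along the
-- live odd entries of the row below (E^(⌊z/2⌋−1)), and down again (D) onto that
-- entry, which is the co-successor of the next live entry u + z + 1.

module Submission where

open import Defs
open import Algebra.Bundles using (AbelianGroup)
open import Data.Bool using (Bool; true; false; not; _∨_; _∧_)
open import Data.Empty using (⊥-elim)
open import Data.Bool.Properties using (∧-identityʳ; not-involutive)
open import Data.Fin using (Fin; toℕ; fromℕ<; _≟_) renaming (zero to fzero; suc to fsuc)
open import Data.Fin.Properties using (toℕ-fromℕ<; toℕ-injective; toℕ<n)
open import Data.Integer as ℤ using (ℤ; +_; -[1+_]; _/ℕ_; _%ℕ_)
open import Data.Integer.DivMod using (a≡a%ℕn+[a/ℕn]*n; n%ℕd<d)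
import Data.Integer.Properties as ℤP
import Data.Integer.Tactic.RingSolver as ℤ-Ring
open import Data.List using (List; []; _∷_; _++_; foldl; foldr; map; allFin; replicate)
open import Data.List.Properties using (map-tabulate; map-++; foldl-++)
open import Data.List.Relation.Unary.All as All using (All; []; _∷_)
open import Data.List.Relation.Unary.All.Properties using (map⁺)
open import Data.Nat as ℕ using (ℕ; zero; suc; _+_; _*_; _∸_; _/_; _%_; _≤_; _<_; z≤n; s≤s; NonZero)
open import Data.Nat.DivMod using (m%n<n; m<n⇒m%n≡m; [m+n]%n≡m%n; m%n%n≡m%n; %-distribˡ-+; n%n≡0; m≡m%n+[m/n]*n; m≥n⇒m/n>0)
open import Data.Nat.Properties
  using ( +-suc; +-comm; +-assoc; +-identityʳ; +-cancelˡ-≡; +-mono-≤; +-monoʳ-≤; 1+n≢n; suc-injective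
        ; <⇒≢; <⇒≤; <-irrefl; <-≤-trans; ≤-<-trans; <-trans; ≤-trans; ≤-refl; ≤-reflexive; n≤1+n; n<1+n
        ; m≤n*m; m≤n+m; m≤n⇒m<n∨m≡n; m+[n∸m]≡n; module ≤-Reasoning)
import Data.Nat.Tactic.RingSolver as ℕ-Ring
open import Data.Product using (_×_; _,_; proj₁; proj₂)
open import Data.Sum using (_⊎_; inj₁; inj₂; [_,_]′)
open import Function using (id; _∘_)
open import Relation.Binary.PropositionalEquality
open import Relation.Nullary using (¬_; Dec; yes; no; contradiction)
open import Relation.Nullary.Decidable using (dec-true; dec-false)
open import Algebra.Properties.Group (AbelianGroup.group ℤP.+-0-abelianGroup) using () renaming (∙-cancelˡ to ℤ-+-cancelˡ)

nor : Bool → Bool → Bool → Bool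
nor a b c = not (a ∨ b ∨ c)

module Cycle (m : ℕ) where

  n : ℕ
  n = suc m

  wrap : ℕ → Fin n
  wrap k = fromℕ< (m%n<n k n)

  left right : Fin n → Fin n
  left j = wrap (toℕ j + m)
  right j = wrap (suc (toℕ j))

  toℕ-wrap : ∀ k → toℕ (wrap k) ≡ k % n
  toℕ-wrap k = toℕ-fromℕ< (m%n<n k n)

  toℕ-wrap-< : ∀ {k} → k < n → toℕ (wrap k) ≡ k
  toℕ-wrap-< {k} k<n = trans (toℕ-wrap k) (m<n⇒m%n≡m k<n)

  wrap-% : ∀ k l → k % n ≡ l % n → wrap k ≡ wrap l
  wrap-% k l eq = toℕ-injective (trans (toℕ-wrap k) (trans eq (sym (toℕ-wrap l))))

  wrap-toℕ : (j : Fin n) → wrap (toℕ j) ≡ j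
  wrap-toℕ j = toℕ-injective (toℕ-wrap-< (toℕ<n j))

  wrap-+n : ∀ k → wrap (k + n) ≡ wrap k
  wrap-+n k = wrap-% (k + n) k ([m+n]%n≡m%n k n)

  [k%n+l]%n≡[k+l]%n : ∀ k l → (k % n + l) % n ≡ (k + l) % n
  [k%n+l]%n≡[k+l]%n k l = begin
    (k % n + l) % n           ≡⟨ %-distribˡ-+ (k % n) l n ⟩
    (k % n % n + l % n) % n   ≡⟨ cong (λ t → (t + l % n) % n) (m%n%n≡m%n k n) ⟩
    (k % n + l % n) % n       ≡⟨ %-distribˡ-+ k l n ⟨
    (k + l) % n               ∎
    where open ≡-Reasoning

  right-wrap : ∀ k → right (wrap k) ≡ wrap (suc k)
  right-wrap k = wrap-% (suc (toℕ (wrap k))) (suc k) (begin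
    suc (toℕ (wrap k)) % n  ≡⟨ cong (λ t → suc t % n) (toℕ-wrap k) ⟩
    (1 + k % n) % n         ≡⟨ cong (_% n) (+-comm 1 (k % n)) ⟩
    (k % n + 1) % n         ≡⟨ [k%n+l]%n≡[k+l]%n k 1 ⟩
    (k + 1) % n             ≡⟨ cong (_% n) (+-comm k 1) ⟩
    suc k % n               ∎)
    where open ≡-Reasoning

  left-wrap : ∀ k → left (wrap (suc k)) ≡ wrap k
  left-wrap k = begin
    wrap (toℕ (wrap (suc k)) + m)  ≡⟨ wrap-% (toℕ (wrap (suc k)) + m) (suc k % n + m)
                                        (cong (λ t → (t + m) % n) (toℕ-wrap (suc k))) ⟩
    wrap (suc k % n + m)           ≡⟨ wrap-% (suc k % n + m) (suc k + m) ([k%n+l]%n≡[k+l]%n (suc k) m) ⟩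
    wrap (suc k + m)               ≡⟨ cong wrap (sym (+-suc k m)) ⟩
    wrap (k + n)                   ≡⟨ wrap-+n k ⟩
    wrap k                         ∎
    where open ≡-Reasoning

  right-left : (j : Fin n) → right (left j) ≡ j
  right-left j = begin
    right (wrap (toℕ j + m))  ≡⟨ right-wrap (toℕ j + m) ⟩
    wrap (suc (toℕ j + m))    ≡⟨ cong wrap (sym (+-suc (toℕ j) m)) ⟩
    wrap (toℕ j + n)          ≡⟨ wrap-+n (toℕ j) ⟩
    wrap (toℕ j)              ≡⟨ wrap-toℕ j ⟩
    j                         ∎
    where open ≡-Reasoning

  left-right : (j : Fin n) → left (right j) ≡ j
  left-right j = trans (left-wrap (toℕ j)) (wrap-toℕ j)

  module _ (1≤m : 1 ≤ m) where

    right≢id : (j : Fin n) → right j ≢ j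
    right≢id j eq with m≤n⇒m<n∨m≡n (toℕ<n j)
    ... | inj₁ 1+j<n = 1+n≢n (trans (sym (toℕ-wrap-< 1+j<n)) (cong toℕ eq))
    ... | inj₂ 1+j≡n = <⇒≢ 1≤m (sym (trans (sym (suc-injective 1+j≡n)) j≡0))
      where
      j≡0 : toℕ j ≡ 0
      j≡0 = begin
        toℕ j               ≡⟨ cong toℕ eq ⟨
        toℕ (right j)       ≡⟨ toℕ-wrap (suc (toℕ j)) ⟩
        suc (toℕ j) % n     ≡⟨ cong (_% n) 1+j≡n ⟩
        n % n               ≡⟨ n%n≡0 n ⟩
        0                   ∎
        where open ≡-Reasoning

    left≢id : (j : Fin n) → left j ≢ j
    left≢id j eq = right≢id j (trans (cong right (sym eq)) (right-left j))

module Toggles (m : ℕ) where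
  open Cycle m
  open ≡-Reasoning

  set-≡ : (y : Config n) (k : Fin n) (b : Bool) → set y k b k ≡ b
  set-≡ y k b with k ≟ k
  ... | yes _ = refl
  ... | no k≢k = contradiction refl k≢k

  set-≢ : (y : Config n) (k : Fin n) (b : Bool) (j : Fin n) → j ≢ k → set y k b j ≡ y j
  set-≢ y k b j j≢k with j ≟ k
  ... | yes j≡k = contradiction j≡k j≢k
  ... | no _ = refl

  set-set : (y : Config n) (k : Fin n) (b c : Bool) → set (set y k b) k c ≗ set y k c
  set-set y k b c j with j ≟ k
  ... | yes _ = refl
  ... | no _ = refl

  set-id : (y : Config n) (k : Fin n) (b : Bool) → y k ≡ b → set y k b ≗ y
  set-id y k b yk≡b j with j ≟ k
  ... | yes refl = sym yk≡b
  ... | no _ = refl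

  set-cong : {y y′ : Config n} (k : Fin n) (b : Bool) → y ≗ y′ → set y k b ≗ set y′ k b
  set-cong k b y≗y′ j with j ≟ k
  ... | yes _ = refl
  ... | no _ = y≗y′ j

  Independent-⊆ : {y y′ : Config n} → (∀ j → y′ j ≡ true → y j ≡ true) →
                  Independent y → Independent y′
  Independent-⊆ {y} {y′} y′⊆y iy i with y′ i in y′i | y′ (right i) in y′ri
  ... | false | _ = refl
  ... | true | false = refl
  ... | true | true = subst₂ (λ a b → a ∧ b ≡ false) (y′⊆y i y′i) (y′⊆y (right i) y′ri) (iy i)

  Independent-≗ : {y y′ : Config n} → y ≗ y′ → Independent y → Independent y′
  Independent-≗ y≗y′ = Independent-⊆ (λ j y′j → trans (y≗y′ j) y′j)

  toggle-live : {y : Config n} {k : Fin n} → y k ≡ true → toggle k y ≡ set y k false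
  toggle-live yk rewrite yk = refl

  toggle-free : {y : Config n} {k : Fin n} → y k ≡ false → Independent (set y k true) →
                toggle k y ≡ set y k true
  toggle-free {y} {k} yk ind rewrite yk | dec-true (independent? (set y k true)) ind = refl

  toggle-blocked : {y : Config n} {k : Fin n} → y k ≡ false → ¬ Independent (set y k true) →
                   toggle k y ≡ y
  toggle-blocked {y} {k} yk ¬ind rewrite yk | dec-false (independent? (set y k true)) ¬ind = refl

  module _ (y : Config n) (k : Fin n) where

    toggle-elim : (P : Config n → Set) →
                  (y k ≡ true → P (set y k false)) →
                  (y k ≡ false → Independent (set y k true) → P (set y k true)) →
                  (y k ≡ false → ¬ Independent (set y k true) → P y) →
                  P (toggle k y)
    toggle-elim P live free blocked = cases (y k) refl (independent? (set y k true))
      where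
      cases : (b : Bool) → y k ≡ b → Dec (Independent (set y k true)) → P (toggle k y)
      cases true yk _ = subst P (sym (toggle-live yk)) (live yk)
      cases false yk (yes ind) = subst P (sym (toggle-free yk ind)) (free yk ind)
      cases false yk (no ¬ind) = subst P (sym (toggle-blocked yk ¬ind)) (blocked yk ¬ind)

    toggle-≢ : (j : Fin n) → j ≢ k → toggle k y j ≡ y j
    toggle-≢ j j≢k = toggle-elim (λ c → c j ≡ y j)
      (λ _ → set-≢ y k false j j≢k) (λ _ _ → set-≢ y k true j j≢k) (λ _ _ → refl)

    toggle-Independent : Independent y → Independent (toggle k y)
    toggle-Independent iy = toggle-elim Independent
      (λ _ → Independent-⊆ cleared⊆y iy) (λ _ ind → ind) (λ _ _ → iy)
      where
      cleared⊆y : ∀ j → set y k false j ≡ true → y j ≡ true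
      cleared⊆y j live with j ≟ k
      ... | yes _ = contradiction live λ ()
      ... | no _ = live

    toggle-involutive : Independent y → toggle k (toggle k y) ≗ y
    toggle-involutive iy j = toggle-elim (λ c → toggle k c j ≡ y j) live-case free-case
      (λ yk ¬ind → cong-app (toggle-blocked yk ¬ind) j)
      where
      live-case : y k ≡ true → toggle k (set y k false) j ≡ y j
      live-case yk = begin
        toggle k (set y k false) j    ≡⟨ cong-app (toggle-free (set-≡ y k false) (Independent-≗ restored iy)) j ⟩
        set (set y k false) k true j  ≡⟨ restored j ⟨
        y j                           ∎
        where
        restored : y ≗ set (set y k false) k true
        restored i = sym (trans (set-set y k false true i) (set-id y k true yk i))
      free-case : y k ≡ false → Independent (set y k true) → toggle k (set y k true) j ≡ y j
      free-case yk _ = begin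
        toggle k (set y k true) j     ≡⟨ cong-app (toggle-live (set-≡ y k true)) j ⟩
        set (set y k true) k false j  ≡⟨ set-set y k true false j ⟩
        set y k false j               ≡⟨ set-id y k false yk j ⟩
        y j                           ∎

    toggle-cong : (y′ : Config n) → y ≗ y′ → toggle k y ≗ toggle k y′
    toggle-cong y′ y≗y′ j = toggle-elim (λ c → c j ≡ toggle k y′ j)
      (λ yk → trans (set-cong k false y≗y′ j) (sym (cong-app (toggle-live (transfer yk)) j)))
      (λ yk ind → trans (set-cong k true y≗y′ j)
                        (sym (cong-app (toggle-free (transfer yk) (Independent-≗ (set-cong k true y≗y′) ind)) j)))
      (λ yk ¬ind → trans (y≗y′ j)
                         (sym (cong-app (toggle-blocked (transfer yk) (¬ind ∘ Independent-≗ (set-cong k true (sym ∘ y≗y′)))) j)))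
      where
      transfer : ∀ {b} → y k ≡ b → y′ k ≡ b
      transfer = trans (sym (y≗y′ k))

  module _ (1≤m : 1 ≤ m) (S : Config n) (j : Fin n) where

    neighbours-free : Independent (set S j true) → S (left j) ≡ false × S (right j) ≡ false
    neighbours-free ind = left-free , right-free
      where
      right-free : S (right j) ≡ false
      right-free = begin
        S (right j)                              ≡⟨ set-≢ S j true (right j) (right≢id 1≤m j) ⟨
        true ∧ set S j true (right j)            ≡⟨ cong (_∧ set S j true (right j)) (set-≡ S j true) ⟨
        set S j true j ∧ set S j true (right j)  ≡⟨ ind j ⟩
        false                                    ∎
      left-free : S (left j) ≡ false
      left-free = begin
        S (left j)                                             ≡⟨ ∧-identityʳ (S (left j)) ⟨
        S (left j) ∧ true                                      ≡⟨ cong₂ _∧_ (set-≢ S j true (left j) (left≢id 1≤m j))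
                                                                    (trans (cong (set S j true) (right-left j)) (set-≡ S j true)) ⟨
        set S j true (left j) ∧ set S j true (right (left j))  ≡⟨ ind (left j) ⟩
        false                                                  ∎

    free-neighbours : Independent S → S (left j) ≡ false → S (right j) ≡ false → Independent (set S j true)
    free-neighbours iS left-free right-free i = edge (i ≟ j) (right i ≟ j)
      where
      edge : Dec (i ≡ j) → Dec (right i ≡ j) → set S j true i ∧ set S j true (right i) ≡ false
      edge (yes refl) _ = begin
        set S j true j ∧ set S j true (right j)  ≡⟨ cong₂ _∧_ (set-≡ S j true) (set-≢ S j true (right j) (right≢id 1≤m j)) ⟩
        S (right j)                              ≡⟨ right-free ⟩
        false                                    ∎
      edge (no i≢j) (yes ri≡j) = begin
        set S j true i ∧ set S j true (right i)  ≡⟨ cong₂ _∧_ (set-≢ S j true i i≢j) (trans (cong (set S j true) ri≡j) (set-≡ S j true)) ⟩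
        S i ∧ true                               ≡⟨ ∧-identityʳ (S i) ⟩
        S i                                      ≡⟨ cong S (trans (sym (left-right i)) (cong left ri≡j)) ⟩
        S (left j)                               ≡⟨ left-free ⟩
        false                                    ∎
      edge (no i≢j) (no ri≢j) = trans (cong₂ _∧_ (set-≢ S j true i i≢j) (set-≢ S j true (right i) ri≢j)) (iS i)

    toggle-self : Independent S → toggle j S j ≡ nor (S j) (S (left j)) (S (right j))
    toggle-self iS = toggle-elim S j (λ c → c j ≡ nor (S j) (S (left j)) (S (right j)))
      (λ Sj → trans (set-≡ S j false) (cong (λ b → nor b (S (left j)) (S (right j))) (sym Sj)))
      free-case blocked-case
      where
      free-case : S j ≡ false → Independent (set S j true) → set S j true j ≡ nor (S j) (S (left j)) (S (right j))
      free-case Sj ind = begin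
        set S j true j                             ≡⟨ set-≡ S j true ⟩
        true                                       ≡⟨ cong₂ (nor false) (proj₁ (neighbours-free ind)) (proj₂ (neighbours-free ind)) ⟨
        nor false (S (left j)) (S (right j))       ≡⟨ cong (λ b → nor b (S (left j)) (S (right j))) Sj ⟨
        nor (S j) (S (left j)) (S (right j))       ∎
      blocked-case : S j ≡ false → ¬ Independent (set S j true) → S j ≡ nor (S j) (S (left j)) (S (right j))
      blocked-case Sj ¬ind = begin
        S j                                        ≡⟨ Sj ⟩
        false                                      ≡⟨ some-neighbour-live ⟨
        nor false (S (left j)) (S (right j))       ≡⟨ cong (λ b → nor b (S (left j)) (S (right j))) Sj ⟨
        nor (S j) (S (left j)) (S (right j))       ∎
        where
        some-neighbour-live : nor false (S (left j)) (S (right j)) ≡ false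
        some-neighbour-live with S (left j) in left-j | S (right j) in right-j
        ... | true | _ = refl
        ... | false | true = refl
        ... | false | false = contradiction (free-neighbours iS left-j right-j) ¬ind

allFin-suc : ∀ k → allFin (suc k) ≡ fzero ∷ map fsuc (allFin k)
allFin-suc k = cong (fzero ∷_) (sym (map-tabulate id fsuc))

record AllFinSplit {k : ℕ} (j : Fin k) : Set where
  field
    before after : List (Fin k)
    split : allFin k ≡ before ++ j ∷ after
    before< : All (λ i → toℕ i < toℕ j) before
    after> : All (λ i → toℕ j < toℕ i) after

allFin-split : ∀ {k} (j : Fin k) → AllFinSplit j
allFin-split {suc k} fzero = record
  { before = [] ; after = map fsuc (allFin k) ; split = allFin-suc k
  ; before< = [] ; after> = map⁺ (All.universal (λ _ → s≤s z≤n) (allFin k)) }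
allFin-split {suc k} (fsuc j) = record
  { before = fzero ∷ map fsuc before ; after = map fsuc after
  ; split = trans (allFin-suc k) (cong (fzero ∷_) (trans (cong (map fsuc) split) (map-++ fsuc before (j ∷ after))))
  ; before< = s≤s z≤n ∷ map⁺ (All.map s≤s before<) ; after> = map⁺ (All.map s≤s after>) }
  where open AllFinSplit (allFin-split j)

module Sweeps (m : ℕ) where
  open Cycle m
  open Toggles m

  sweep : Config n → List (Fin n) → Config n
  sweep = foldl (λ y k → toggle k y)

  sweep-≢ : (y : Config n) (ks : List (Fin n)) (j : Fin n) → All (j ≢_) ks → sweep y ks j ≡ y j
  sweep-≢ y [] j [] = refl
  sweep-≢ y (k ∷ ks) j (j≢k ∷ j∉ks) = trans (sweep-≢ (toggle k y) ks j j∉ks) (toggle-≢ y k j j≢k)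

  sweep-Independent : (y : Config n) (ks : List (Fin n)) → Independent y → Independent (sweep y ks)
  sweep-Independent y [] iy = iy
  sweep-Independent y (k ∷ ks) iy = sweep-Independent (toggle k y) ks (toggle-Independent y k iy)

  sweep-cong : (y y′ : Config n) (ks : List (Fin n)) → y ≗ y′ → sweep y ks ≗ sweep y′ ks
  sweep-cong y y′ [] y≗y′ = y≗y′
  sweep-cong y y′ (k ∷ ks) y≗y′ = sweep-cong (toggle k y) (toggle k y′) ks (toggle-cong y k y′ y≗y′)

  foldr-toggle-Independent : (y : Config n) (ks : List (Fin n)) → Independent y → Independent (foldr toggle y ks)
  foldr-toggle-Independent y [] iy = iy
  foldr-toggle-Independent y (k ∷ ks) iy = toggle-Independent (foldr toggle y ks) k (foldr-toggle-Independent y ks iy)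

  sweep-foldr-toggle : (y : Config n) (ks : List (Fin n)) → Independent y → sweep (foldr toggle y ks) ks ≗ y
  sweep-foldr-toggle y [] iy j = refl
  sweep-foldr-toggle y (k ∷ ks) iy j =
    trans (sweep-cong _ _ ks (toggle-involutive (foldr toggle y ks) k (foldr-toggle-Independent y ks iy)) j)
          (sweep-foldr-toggle y ks iy j)

  τ-Independent : (y : Config n) → Independent y → Independent (τ y)
  τ-Independent y = sweep-Independent y (allFin n)

  τ⁻¹-Independent : (y : Config n) → Independent y → Independent (τ⁻¹ y)
  τ⁻¹-Independent y = foldr-toggle-Independent y (allFin n)

  τ∘τ⁻¹ : (y : Config n) → Independent y → τ (τ⁻¹ y) ≗ y
  τ∘τ⁻¹ y = sweep-foldr-toggle y (allFin n)

  iter-Independent : (f : Config n → Config n) → (∀ y → Independent y → Independent (f y)) →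
                     ∀ k y → Independent y → Independent (iter k f y)
  iter-Independent f f-Independent zero y iy = iy
  iter-Independent f f-Independent (suc k) y iy = f-Independent (iter k f y) (iter-Independent f f-Independent k y iy)

  module Halfway (1≤m : 1 ≤ m) (y : Config n) (iy : Independent y) (j : Fin n) where
    open AllFinSplit (allFin-split j)

    halfway : Config n
    halfway = sweep y before

    τ-from-halfway : τ y ≡ sweep (toggle j halfway) after
    τ-from-halfway = trans (cong (sweep y) split) (foldl-++ _ y before (j ∷ after))

    halfway-≥ : (k : Fin n) → toℕ j ≤ toℕ k → halfway k ≡ y k
    halfway-≥ k j≤k = sweep-≢ y before k (All.map (λ i<j k≡i → <-irrefl (cong toℕ (sym k≡i)) (<-≤-trans i<j j≤k)) before<)

    halfway-< : (k : Fin n) → toℕ k < toℕ j → halfway k ≡ τ y k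
    halfway-< k k<j = sym (begin
      τ y k                          ≡⟨ cong-app τ-from-halfway k ⟩
      sweep (toggle j halfway) after k ≡⟨ sweep-≢ _ after k (All.map (λ j<i k≡i → <-irrefl (cong toℕ k≡i) (<-trans k<j j<i)) after>) ⟩
      toggle j halfway k             ≡⟨ toggle-≢ halfway j k (λ k≡j → <-irrefl (cong toℕ k≡j) k<j) ⟩
      halfway k                      ∎)
      where open ≡-Reasoning

    τ-at : τ y j ≡ nor (halfway j) (halfway (left j)) (halfway (right j))
    τ-at = begin
      τ y j                            ≡⟨ cong-app τ-from-halfway j ⟩
      sweep (toggle j halfway) after j ≡⟨ sweep-≢ _ after j (All.map (λ j<i j≡i → <-irrefl (cong toℕ j≡i) j<i) after>) ⟩
      toggle j halfway j               ≡⟨ toggle-self 1≤m halfway j (sweep-Independent y before iy) ⟩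
      nor (halfway j) (halfway (left j)) (halfway (right j)) ∎
      where open ≡-Reasoning

private
  +r+q*n-ring : ∀ r r′ q q′ n → r ℤ.+ q ℤ.* n ≡ r′ ℤ.+ q′ ℤ.* n → r ≡ r′ ℤ.+ (q′ ℤ.- q) ℤ.* n
  +r+q*n-ring r r′ q q′ n eq = trans (lemma₁ r q n) (trans (cong (ℤ._- q ℤ.* n) eq) (lemma₂ r′ q′ q n))
    where
    lemma₁ : ∀ r q n → r ≡ (r ℤ.+ q ℤ.* n) ℤ.- q ℤ.* n
    lemma₁ = ℤ-Ring.solve-∀
    lemma₂ : ∀ r′ q′ q n → (r′ ℤ.+ q′ ℤ.* n) ℤ.- q ℤ.* n ≡ r′ ℤ.+ (q′ ℤ.- q) ℤ.* n
    lemma₂ = ℤ-Ring.solve-∀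

  negate-multiple : ∀ r r′ k n → r ≡ r′ ℤ.+ ℤ.- k ℤ.* n → r′ ≡ r ℤ.+ k ℤ.* n
  negate-multiple r r′ k n eq = trans (lemma r′ k n) (cong (ℤ._+ k ℤ.* n) (sym eq))
    where
    lemma : ∀ r′ k n → r′ ≡ (r′ ℤ.+ ℤ.- k ℤ.* n) ℤ.+ k ℤ.* n
    lemma = ℤ-Ring.solve-∀

  remainder-bound : ∀ {n r r′} k → r < n → + r ≢ + r′ ℤ.+ + suc k ℤ.* + n
  remainder-bound {n} {r} {r′} k r<n eq = <-irrefl refl (<-≤-trans r<n (begin
    n                      ≤⟨ m≤n*m n (suc k) ⟩
    suc k ℕ.* n            ≤⟨ m≤n+m _ r′ ⟩
    r′ ℕ.+ suc k ℕ.* n     ≡⟨ ℤP.+-injective (trans (ℤP.pos-+ r′ _)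
                                (trans (cong (λ t → + r′ ℤ.+ t) (ℤP.pos-* (suc k) n)) (sym eq))) ⟩
    r                      ∎))
    where open ≤-Reasoning

euclid-unique : ∀ {n r r′} (q q′ : ℤ) → r < n → r′ < n →
                + r ℤ.+ q ℤ.* + n ≡ + r′ ℤ.+ q′ ℤ.* + n → r ≡ r′ × q ≡ q′
euclid-unique {n} {r} {r′} q q′ r<n r′<n eq with q′ ℤ.- q in q′-q | +r+q*n-ring (+ r) (+ r′) q q′ (+ n) eq
... | + zero | r≡r′ = ℤP.+-injective (trans r≡r′ (ℤP.+-identityʳ (+ r′))) , sym (ℤP.i-j≡0⇒i≡j q′ q q′-q)
... | + suc k | r≡r′ = ⊥-elim (remainder-bound k r<n r≡r′)
... | -[1+ k ] | r≡r′ = ⊥-elim (remainder-bound k r′<n (negate-multiple (+ r) (+ r′) (+ suc k) (+ n) r≡r′))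

%ℕ-/ℕ-+r+q*n : ∀ {n r} .{{_ : NonZero n}} (q : ℤ) → r < n →
               (+ r ℤ.+ q ℤ.* + n) %ℕ n ≡ r × (+ r ℤ.+ q ℤ.* + n) /ℕ n ≡ q
%ℕ-/ℕ-+r+q*n {n} q r<n = euclid-unique (p /ℕ n) q (n%ℕd<d p n) r<n (sym (a≡a%ℕn+[a/ℕn]*n p n))
  where p = + _ ℤ.+ q ℤ.* + n

private
  next-row : ∀ r q N → (r ℤ.+ q ℤ.* N) ℤ.+ N ≡ r ℤ.+ (q ℤ.+ + 1) ℤ.* N
  next-row = ℤ-Ring.solve-∀
  wrap-left : ∀ q M → (+ 0 ℤ.+ q ℤ.* (+ 1 ℤ.+ M)) ℤ.+ M ≡ M ℤ.+ q ℤ.* (+ 1 ℤ.+ M)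
  wrap-left = ℤ-Ring.solve-∀
  step-left : ∀ r q M → ((+ 1 ℤ.+ r) ℤ.+ q ℤ.* (+ 1 ℤ.+ M)) ℤ.+ M ≡ r ℤ.+ (q ℤ.+ + 1) ℤ.* (+ 1 ℤ.+ M)
  step-left = ℤ-Ring.solve-∀
  wrap-right : ∀ q M → (M ℤ.+ q ℤ.* (+ 1 ℤ.+ M)) ℤ.+ + 1 ≡ + 0 ℤ.+ (q ℤ.+ + 1) ℤ.* (+ 1 ℤ.+ M)
  wrap-right = ℤ-Ring.solve-∀
  step-right : ∀ r q N → (r ℤ.+ q ℤ.* N) ℤ.+ + 1 ≡ (+ 1 ℤ.+ r) ℤ.+ q ℤ.* N
  step-right = ℤ-Ring.solve-∀

module Scroll (m : ℕ) (1≤m : 1 ≤ m) (x : Config (suc m)) (ix : Independent x) where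
  open Cycle m
  open Sweeps m

  row : ℤ → Config n
  row q = τ^ q x

  row-Independent : ∀ q → Independent (row q)
  row-Independent (+ k) = iter-Independent τ τ-Independent k x ix
  row-Independent -[1+ k ] = iter-Independent τ⁻¹ τ⁻¹-Independent (suc k) x ix

  row-suc : ∀ q → row (q ℤ.+ + 1) ≗ τ (row q)
  row-suc (+ k) j rewrite +-comm k 1 = refl
  row-suc -[1+ zero ] j = sym (τ∘τ⁻¹ x ix j)
  row-suc -[1+ suc k ] j = sym (τ∘τ⁻¹ (row -[1+ k ]) (row-Independent -[1+ k ]) j)

  tape-row : ∀ q {r} → r < n → tape x (+ r ℤ.+ q ℤ.* + n) ≡ row q (wrap r)
  tape-row q r<n = cong₂ (λ q′ r′ → at (τ^ q′ x) r′) (proj₂ quot-rem) (proj₁ quot-rem)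
    where quot-rem = %ℕ-/ℕ-+r+q*n q r<n

  sweeping : ℤ → ℕ → Config n
  sweeping q r = Halfway.halfway 1≤m (row q) (row-Independent q) (wrap r)

  sweeping-done : ∀ q {r k} → r < n → k < r → sweeping q r (wrap k) ≡ tape x (+ k ℤ.+ (q ℤ.+ + 1) ℤ.* + n)
  sweeping-done q {r} {k} r<n k<r = begin
    sweeping q r (wrap k)                  ≡⟨ halfway-< (wrap k) (subst₂ _<_ (sym (toℕ-wrap-< k<n)) (sym (toℕ-wrap-< r<n)) k<r) ⟩
    τ (row q) (wrap k)                     ≡⟨ row-suc q (wrap k) ⟨
    row (q ℤ.+ + 1) (wrap k)               ≡⟨ tape-row (q ℤ.+ + 1) k<n ⟨
    tape x (+ k ℤ.+ (q ℤ.+ + 1) ℤ.* + n)   ∎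
    where
    open Halfway 1≤m (row q) (row-Independent q) (wrap r)
    open ≡-Reasoning
    k<n = <-trans k<r r<n

  sweeping-pending : ∀ q {r k} → r ≤ k → k < n → sweeping q r (wrap k) ≡ tape x (+ k ℤ.+ q ℤ.* + n)
  sweeping-pending q {r} {k} r≤k k<n = begin
    sweeping q r (wrap k)       ≡⟨ halfway-≥ (wrap k)
                                     (subst₂ _≤_ (sym (toℕ-wrap-< (≤-<-trans r≤k k<n))) (sym (toℕ-wrap-< k<n)) r≤k) ⟩
    row q (wrap k)              ≡⟨ tape-row q k<n ⟨
    tape x (+ k ℤ.+ q ℤ.* + n)  ∎
    where
    open Halfway 1≤m (row q) (row-Independent q) (wrap r)
    open ≡-Reasoning

  sweeping-left : ∀ q r → r < n → sweeping q r (left (wrap r)) ≡ tape x ((+ r ℤ.+ q ℤ.* + n) ℤ.+ + m)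
  -- left (wrap 0) computes to wrap m
  sweeping-left q zero _ = trans (sweeping-pending q z≤n ≤-refl) (cong (tape x) (sym (wrap-left q (+ m))))
  sweeping-left q (suc r) r<n = begin
    sweeping q (suc r) (left (wrap (suc r)))        ≡⟨ cong (sweeping q (suc r)) (left-wrap r) ⟩
    sweeping q (suc r) (wrap r)                     ≡⟨ sweeping-done q r<n (n<1+n r) ⟩
    tape x (+ r ℤ.+ (q ℤ.+ + 1) ℤ.* + n)            ≡⟨ cong (tape x) (step-left (+ r) q (+ m)) ⟨
    tape x ((+ suc r ℤ.+ q ℤ.* + n) ℤ.+ + m)        ∎
    where open ≡-Reasoning

  sweeping-right : ∀ q r → r < n → sweeping q r (right (wrap r)) ≡ tape x ((+ r ℤ.+ q ℤ.* + n) ℤ.+ + 1)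
  sweeping-right q r r<n with m≤n⇒m<n∨m≡n r<n
  ... | inj₁ 1+r<n = begin
    sweeping q r (right (wrap r))                   ≡⟨ cong (sweeping q r) (right-wrap r) ⟩
    sweeping q r (wrap (suc r))                     ≡⟨ sweeping-pending q (n≤1+n r) 1+r<n ⟩
    tape x (+ suc r ℤ.+ q ℤ.* + n)                  ≡⟨ cong (tape x) (step-right (+ r) q (+ n)) ⟨
    tape x ((+ r ℤ.+ q ℤ.* + n) ℤ.+ + 1)            ∎
    where open ≡-Reasoning
  ... | inj₂ 1+r≡n with refl ← suc-injective 1+r≡n = begin
    sweeping q m (right (wrap m))                   ≡⟨ cong (sweeping q m) (trans (right-wrap m) (wrap-+n 0)) ⟩
    sweeping q m (wrap 0)                           ≡⟨ sweeping-done q r<n 1≤m ⟩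
    tape x (+ 0 ℤ.+ (q ℤ.+ + 1) ℤ.* + n)            ≡⟨ cong (tape x) (wrap-right q (+ m)) ⟨
    tape x ((+ m ℤ.+ q ℤ.* + n) ℤ.+ + 1)            ∎
    where open ≡-Reasoning

  tape-recurrence-at : ∀ q r → r < n →
    tape x ((+ r ℤ.+ q ℤ.* + n) ℤ.+ + n) ≡
    nor (tape x (+ r ℤ.+ q ℤ.* + n)) (tape x ((+ r ℤ.+ q ℤ.* + n) ℤ.+ + m)) (tape x ((+ r ℤ.+ q ℤ.* + n) ℤ.+ + 1))
  tape-recurrence-at q r r<n = begin
    tape x (p ℤ.+ + n)                     ≡⟨ cong (tape x) (next-row (+ r) q (+ n)) ⟩
    tape x (+ r ℤ.+ (q ℤ.+ + 1) ℤ.* + n)   ≡⟨ tape-row (q ℤ.+ + 1) r<n ⟩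
    row (q ℤ.+ + 1) (wrap r)               ≡⟨ row-suc q (wrap r) ⟩
    τ (row q) (wrap r)                     ≡⟨ τ-at ⟩
    nor (S (wrap r)) (S (left (wrap r))) (S (right (wrap r)))
      ≡⟨ cong₂ (λ a b → nor a b (S (right (wrap r)))) (sweeping-pending q ≤-refl r<n) (sweeping-left q r r<n) ⟩
    nor (tape x p) (tape x (p ℤ.+ + m)) (S (right (wrap r)))
      ≡⟨ cong (nor (tape x p) (tape x (p ℤ.+ + m))) (sweeping-right q r r<n) ⟩
    nor (tape x p) (tape x (p ℤ.+ + m)) (tape x (p ℤ.+ + 1)) ∎
    where
    open Halfway 1≤m (row q) (row-Independent q) (wrap r) renaming (halfway to S)
    open ≡-Reasoning
    p = + r ℤ.+ q ℤ.* + n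

  tape-recurrence : ∀ p → tape x (p ℤ.+ + n) ≡ nor (tape x p) (tape x (p ℤ.+ + m)) (tape x (p ℤ.+ + 1))
  tape-recurrence p =
    subst (λ p → tape x (p ℤ.+ + n) ≡ nor (tape x p) (tape x (p ℤ.+ + m)) (tape x (p ℤ.+ + 1)))
          (sym (a≡a%ℕn+[a/ℕn]*n p n))
          (tape-recurrence-at (p /ℕ n) (p %ℕ n) (n%ℕd<d p n))

odd : ℕ → Bool
odd zero = false
odd (suc k) = not (odd k)

odd-double : ∀ j → odd (j + j) ≡ false
odd-double zero = refl
odd-double (suc j) rewrite +-suc j j | odd-double j = refl

nor-false-false : ∀ b → nor false b false ≡ not b
nor-false-false true = refl
nor-false-false false = refl

nor-true : ∀ a b → nor a b true ≡ false
nor-true true b = refl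
nor-true false true = refl
nor-true false false = refl

nor-not : ∀ a b → nor a b (not a) ≡ false
nor-not true b = refl
nor-not false b = nor-true false b

module ZeroBlockDynamics
  (m : ℕ) (a : ℕ → Bool)
  (recurrence : ∀ k → a (suc m + k) ≡ nor (a k) (a (m + k)) (a (suc k)))
  (z : ℕ) (a-start : a 0 ≡ true) (a-gap : ∀ k → 1 ≤ k → k ≤ z → a k ≡ false) (a-end : a (suc z) ≡ true)
  where

  n : ℕ
  n = suc m

  row₁ row₂ : ℕ → Bool
  row₁ k = a (n + k)
  row₂ k = a (n + (n + k))

  row₁-suc : ∀ k → row₁ (suc k) ≡ nor (a (suc k)) (row₁ k) (a (suc (suc k)))
  row₁-suc k = trans (recurrence (suc k)) (cong (λ i → nor (a (suc k)) (a i) (a (suc (suc k)))) (+-suc m k))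

  row₂-zero : row₂ 0 ≡ nor (row₁ 0) (a (m + (n + 0))) (row₁ 1)
  row₂-zero = trans (recurrence (n + 0)) (cong (λ i → nor (row₁ 0) (a (m + (n + 0))) (a i)) (sym (+-suc n 0)))

  row₂-suc : ∀ k → row₂ (suc k) ≡ nor (row₁ (suc k)) (row₂ k) (row₁ (suc (suc k)))
  row₂-suc k = trans (recurrence (n + suc k))
    (cong₂ (λ i i′ → nor (row₁ (suc k)) (a i) (a i′)) left-index (sym (+-suc n (suc k))))
    where
    left-index : m + (n + suc k) ≡ n + (n + k)
    left-index = trans (+-suc m (m + suc k)) (cong (λ i → suc (m + i)) (+-suc m k))

  row₁-alternates : ∀ k → k < z → row₁ k ≡ odd k
  row₁-alternates zero _ = trans (recurrence 0) (cong (λ b → nor b (a (m + 0)) (a 1)) a-start)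
  row₁-alternates (suc k) 1+k<z = begin
    row₁ (suc k)                                  ≡⟨ row₁-suc k ⟩
    nor (a (suc k)) (row₁ k) (a (suc (suc k)))    ≡⟨ cong₂ (λ b b′ → nor b (row₁ k) b′)
                                                           (a-gap (suc k) (s≤s z≤n) (<⇒≤ 1+k<z))
                                                           (a-gap (suc (suc k)) (s≤s z≤n) 1+k<z) ⟩
    nor false (row₁ k) false                      ≡⟨ nor-false-false (row₁ k) ⟩
    not (row₁ k)                                  ≡⟨ cong not (row₁-alternates k (<-trans (n<1+n k) 1+k<z)) ⟩
    odd (suc k)                                   ∎
    where open ≡-Reasoning

  row₁-gap-end : ∀ {z′} → z ≡ suc z′ → row₁ z ≡ false
  row₁-gap-end {z′} refl = trans (row₁-suc z′)
    (trans (cong (λ b → nor b (row₁ z′) (a (suc z))) (a-gap z (s≤s z≤n) ≤-refl))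
           (trans (cong (nor false (row₁ z′)) a-end) (nor-true false (row₁ z′))))

  row₁-after-end : row₁ (suc z) ≡ false
  row₁-after-end = trans (row₁-suc z) (cong (λ b → nor b (row₁ z) (a (suc (suc z)))) a-end)

  row₂-gap : ∀ k → suc k < z → row₂ k ≡ false
  row₂-gap zero 1<z = begin
    row₂ 0                                   ≡⟨ row₂-zero ⟩
    nor (row₁ 0) (a (m + (n + 0))) (row₁ 1)  ≡⟨ cong₂ (λ b b′ → nor b (a (m + (n + 0))) b′)
                                                      (row₁-alternates 0 (<-trans (n<1+n 0) 1<z)) (row₁-alternates 1 1<z) ⟩
    nor false (a (m + (n + 0))) true         ≡⟨ nor-true false (a (m + (n + 0))) ⟩
    false                                    ∎
    where open ≡-Reasoning
  row₂-gap (suc k) 2+k<z = begin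
    row₂ (suc k)                                      ≡⟨ row₂-suc k ⟩
    nor (row₁ (suc k)) (row₂ k) (row₁ (suc (suc k)))  ≡⟨ cong₂ (λ b b′ → nor b (row₂ k) b′)
                                                               (row₁-alternates (suc k) (<-trans (n<1+n (suc k)) 2+k<z))
                                                               (row₁-alternates (suc (suc k)) 2+k<z) ⟩
    nor (odd (suc k)) (row₂ k) (not (odd (suc k)))    ≡⟨ nor-not (odd (suc k)) (row₂ k) ⟩
    false                                             ∎
    where open ≡-Reasoning

  module Halves (t : ℕ) (z-shape : z ≡ suc (suc (t + t)) ⊎ z ≡ suc (suc (suc (t + t)))) where

    2+2t≤z : suc (suc (t + t)) ≤ z
    2+2t≤z = [ (λ z≡ → ≤-reflexive (sym z≡)) , (λ z≡ → ≤-trans (n≤1+n _) (≤-reflexive (sym z≡))) ]′ z-shape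

    row₁-odd-live : ∀ j → j ≤ t → row₁ (suc (j + j)) ≡ true
    row₁-odd-live j j≤t = trans (row₁-alternates (suc (j + j)) (≤-trans (s≤s (s≤s (+-mono-≤ j≤t j≤t))) 2+2t≤z))
                                (cong not (odd-double j))

    row₂-even-dead : ∀ j → j < t → row₂ (suc (suc (j + j))) ≡ false
    row₂-even-dead j j<t = row₂-gap (suc (suc (j + j)))
      (≤-trans (s≤s (s≤s (subst (_≤ t + t) (+-suc (suc j) j) (+-mono-≤ j<t j<t)))) 2+2t≤z)

    row₁-even-dead : row₁ (suc (suc (t + t))) ≡ false
    row₁-even-dead = [ (λ z≡ → trans (cong row₁ (sym z≡)) (row₁-gap-end z≡))
                     , (λ z≡ → trans (row₁-alternates _ (≤-reflexive (sym z≡))) (trans (not-involutive _) (odd-double t)))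
                     ]′ z-shape

    row₁-past-target : row₁ (suc (suc (suc (t + t)))) ≡ false
    row₁-past-target = [ (λ z≡ → trans (cong (λ k → row₁ (suc k)) (sym z≡)) row₁-after-end)
                       , (λ z≡ → trans (cong row₁ (sym z≡)) (row₁-gap-end z≡))
                       ]′ z-shape

    row₂-before-target : row₂ (suc (t + t)) ≡ false
    row₂-before-target = trans (row₂-suc (t + t))
      (cong (λ b → nor b (row₂ (t + t)) (row₁ (suc (suc (t + t))))) (row₁-odd-live t ≤-refl))

    row₂-target-live : row₂ (suc (suc (t + t))) ≡ true
    row₂-target-live = begin
      row₂ (suc (suc (t + t)))         ≡⟨ row₂-suc (suc (t + t)) ⟩
      nor (row₁ (suc (suc (t + t)))) (row₂ (suc (t + t))) (row₁ (suc (suc (suc (t + t)))))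
                                       ≡⟨ cong₂ (λ b b′ → nor b b′ (row₁ (suc (suc (suc (t + t))))))
                                                row₁-even-dead row₂-before-target ⟩
      nor false false (row₁ (suc (suc (suc (t + t)))))
                                       ≡⟨ cong (nor false false) row₁-past-target ⟩
      true                             ∎
      where open ≡-Reasoning

    row₂-past-target : row₂ (suc (suc (suc (t + t)))) ≡ false
    row₂-past-target = trans (row₂-suc (suc (suc (t + t))))
      (cong₂ (λ b b′ → nor b b′ (row₁ (suc (suc (suc (suc (t + t))))))) row₁-past-target row₂-target-live)

ℤ-+-+-assoc : ∀ u k d → (u ℤ.+ + k) ℤ.+ + d ≡ u ℤ.+ + (k + d)
ℤ-+-+-assoc u k d = trans (ℤP.+-assoc u (+ k) (+ d)) (cong (λ i → u ℤ.+ i) (sym (ℤP.pos-+ k d)))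

module Paths (m : ℕ) (x : Config (suc m)) where
  open Cycle m using (n)

  stride : Letter → ℕ
  stride E = 2
  stride D = suc n

  δ≡stride : ∀ l → δ {n} l ≡ + stride l
  δ≡stride E = refl
  δ≡stride D = refl

  displacement : List Letter → ℕ
  displacement [] = 0
  displacement (l ∷ w) = stride l + displacement w

  displacement-++ : ∀ w v → displacement (w ++ v) ≡ displacement w + displacement v
  displacement-++ [] v = refl
  displacement-++ (l ∷ w) v = trans (cong (λ d → stride l + d) (displacement-++ w v)) (sym (+-assoc (stride l) _ _))

  displacement≡0 : ∀ w → displacement w ≡ 0 → w ≡ []
  displacement≡0 [] _ = refl
  displacement≡0 (E ∷ w) ()
  displacement≡0 (D ∷ w) ()

  Path-end : ∀ {p w q} → Path x p w q → q ≡ p ℤ.+ + displacement w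
  Path-end {p} done = sym (ℤP.+-identityʳ p)
  Path-end {p} (step {l = l} {w = w} _ path) = begin
    _                                               ≡⟨ Path-end path ⟩
    (p ℤ.+ δ l) ℤ.+ + displacement w                ≡⟨ cong (λ d → (p ℤ.+ d) ℤ.+ + displacement w) (δ≡stride l) ⟩
    (p ℤ.+ + stride l) ℤ.+ + displacement w         ≡⟨ ℤ-+-+-assoc p (stride l) (displacement w) ⟩
    p ℤ.+ + displacement (l ∷ w)                    ∎
    where open ≡-Reasoning

  Path⇒ShortestPath : ∀ {p w q} → Path x p w q → ShortestPath x p w q
  Path⇒ShortestPath {p} {w} {q} path = path , prefix-is-all
    where
    prefix-is-all : (w′ v : List Letter) → w′ ++ v ≡ w → Path x p w′ q → v ≡ []
    prefix-is-all w′ v w′++v≡w path′ = displacement≡0 v (+-cancelˡ-≡ (displacement w′) _ _ (begin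
      displacement w′ + displacement v   ≡⟨ displacement-++ w′ v ⟨
      displacement (w′ ++ v)             ≡⟨ cong displacement w′++v≡w ⟩
      displacement w                     ≡⟨ ℤP.+-injective (ℤ-+-cancelˡ p _ _ (trans (sym (Path-end path)) (Path-end path′))) ⟩
      displacement w′                    ≡⟨ +-identityʳ (displacement w′) ⟨
      displacement w′ + 0                ∎))
      where open ≡-Reasoning

private
  D-start : ∀ m → 0 + suc (suc m) ≡ suc m + suc (0 + 0)
  D-start = ℕ-Ring.solve-∀
  E-stride : ∀ m j → suc m + suc (j + j) + 2 ≡ suc m + suc (suc j + suc j)
  E-stride = ℕ-Ring.solve-∀
  E-stride-end : ∀ m j → suc m + suc (j + j) + 2 ≡ suc m + suc (suc (suc (j + j)))
  E-stride-end = ℕ-Ring.solve-∀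
  D-stride : ∀ m j → suc m + suc (j + j) + suc (suc m) ≡ suc m + (suc m + suc (suc (j + j)))
  D-stride = ℕ-Ring.solve-∀
  target-even : ∀ m t → suc (suc (suc (t + t))) + (m + (suc m + 0)) ≡ suc m + (suc m + suc (suc (t + t)))
  target-even = ℕ-Ring.solve-∀
  before-target-even : ∀ m t → suc (suc (suc (t + t))) + (m + (m + 0)) ≡ suc m + (suc m + suc (t + t))
  before-target-even = ℕ-Ring.solve-∀
  target-odd : ∀ m t → suc (suc (suc (suc (t + t)))) + (m + (m + 0)) ≡ suc m + (suc m + suc (suc (t + t)))
  target-odd = ℕ-Ring.solve-∀
  past-target-odd : ∀ m t → suc (suc (suc (suc (t + t)))) + (m + (suc m + 0)) ≡ suc m + (suc m + suc (suc (suc (t + t))))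
  past-target-odd = ℕ-Ring.solve-∀

module Slither (m : ℕ) (1≤m : 1 ≤ m) (x : Config (suc m)) (ix : Independent x)
               (u : ℤ) (z : ℕ) (block : ZeroBlock x u z)
               (t : ℕ) (z-shape : z ≡ suc (suc (t + t)) ⊎ z ≡ suc (suc (suc (t + t)))) where
  open Cycle m using (n)
  open Paths m x

  P : ℕ → ℤ
  P k = u ℤ.+ + k

  a : ℕ → Bool
  a k = tape x (P k)

  a-recurrence : ∀ k → a (suc m + k) ≡ nor (a k) (a (m + k)) (a (suc k))
  a-recurrence k = begin
    tape x (P (n + k))                                                 ≡⟨ cong a (+-comm n k) ⟩
    tape x (P (k + n))                                                 ≡⟨ cong (tape x) (ℤ-+-+-assoc u k n) ⟨
    tape x (P k ℤ.+ + n)                                               ≡⟨ Scroll.tape-recurrence m 1≤m x ix (P k) ⟩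
    nor (a k) (tape x (P k ℤ.+ + m)) (tape x (P k ℤ.+ + 1))            ≡⟨ cong₂ (nor (a k)) (shifted m) (shifted 1) ⟩
    nor (a k) (a (m + k)) (a (suc k))                                  ∎
    where
    open ≡-Reasoning
    shifted : ∀ d → tape x (P k ℤ.+ + d) ≡ a (d + k)
    shifted d = trans (cong (tape x) (ℤ-+-+-assoc u k d)) (cong a (+-comm k d))

  a-start : a 0 ≡ true
  a-start = trans (cong (tape x) (ℤP.+-identityʳ u)) (proj₁ block)

  a-gap : ∀ k → 1 ≤ k → k ≤ z → a k ≡ false
  a-gap = proj₂ (proj₂ block)

  open ZeroBlockDynamics m a a-recurrence z a-start a-gap (proj₁ (proj₂ block)) hiding (n)
  open Halves t z-shape

  not-live : ∀ {p} k → p ≡ P k → a k ≡ false → ¬ Live x p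
  not-live k refl a≡false live with () ← trans (sym a≡false) live

  step-at : ∀ k l k′ {w q} → k + stride l ≡ k′ → a k′ ≡ true → a (k + stride (other l)) ≡ false →
            Path x (P k′) w q → Path x (P k) (l ∷ w) q
  step-at k l k′ k+l≡k′ live dead path = step (subst (Live x) (sym next) live , not-live _ other-next dead)
                                              (subst (λ p → Path x p _ _) (sym next) path)
    where
    shift : ∀ l → P k ℤ.+ δ l ≡ P (k + stride l)
    shift l = trans (cong (λ d → P k ℤ.+ d) (δ≡stride l)) (ℤ-+-+-assoc u k (stride l))
    next : P k ℤ.+ δ l ≡ P k′
    next = trans (shift l) (cong P k+l≡k′)
    other-next : P k ℤ.+ δ (other l) ≡ P (k + stride (other l))
    other-next = shift (other l)

  target : ℤ
  target = P (n + (n + suc (suc (t + t))))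

  E-run : ∀ s j → j + s ≡ t → Path x (P (n + suc (j + j))) (replicate s E ++ D ∷ []) target
  E-run zero j j+0≡t rewrite trans (sym (+-identityʳ j)) j+0≡t =
    step-at _ D _ (D-stride m t) row₂-target-live (trans (cong a (E-stride-end m t)) row₁-past-target) done
  E-run (suc s) j j+s≡t =
    step-at _ E _ (E-stride m j) (row₁-odd-live (suc j) j<t) (trans (cong a (D-stride m j)) (row₂-even-dead j j<t))
            (E-run s (suc j) (trans (sym (+-suc j s)) j+s≡t))
    where
    j<t : suc j ≤ t
    j<t = subst (suc j ≤_) j+s≡t (subst (_≤ j + suc s) (+-comm j 1) (+-monoʳ-≤ j (s≤s z≤n)))

  slither-path : Path x u (D ∷ replicate t E ++ D ∷ []) target
  slither-path = subst (λ p → Path x p _ target) (ℤP.+-identityʳ u)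
    (step-at 0 D _ (D-start m) (row₁-odd-live 0 z≤n) (a-gap 2 (s≤s z≤n) (≤-trans (s≤s (s≤s z≤n)) 2+2t≤z))
             (E-run t 0 refl))

  co-successor : CoSucc x (u ℤ.+ + suc z) target
  co-successor = [ even-gap , odd-gap ]′ z-shape
    where
    next-live = u ℤ.+ + suc z
    offset : ∀ d {k} → suc z + d ≡ k → next-live ℤ.+ + d ≡ P k
    offset d refl = ℤ-+-+-assoc u (suc z) d
    at-2n∸1 : ∀ {k} → suc z + (m + (suc m + 0)) ≡ k → next-live ℤ.+ + (2 * n ∸ 1) ≡ P k
    at-2n∸1 = offset (2 * n ∸ 1)
    at-2n∸2 : ∀ {k} → suc z + (m + (m + 0)) ≡ k → next-live ℤ.+ + (2 * n ∸ 2) ≡ P k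
    at-2n∸2 eq = offset (2 * n ∸ 2) (trans (cong (λ d → suc z + (d ∸ 1)) (+-suc m (m + 0))) eq)
    even-gap : z ≡ suc (suc (t + t)) → CoSucc x next-live target
    even-gap refl = inj₂ ( sym (at-2n∸1 (target-even m t)) , row₂-target-live
                         , not-live _ (at-2n∸2 (before-target-even m t)) row₂-before-target)
    odd-gap : z ≡ suc (suc (suc (t + t))) → CoSucc x next-live target
    odd-gap refl = inj₁ ( sym (at-2n∸2 (target-odd m t)) , row₂-target-live
                        , not-live _ (at-2n∸1 (past-target-odd m t)) row₂-past-target)

  subslither : Subslither x u (D ∷ replicate t E ++ D ∷ [])
  subslither = z , block , (λ z≡1 → contradiction z≡1 z≢1) , (λ _ → target , co-successor , Path⇒ShortestPath slither-path)
    where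
    z≢1 : z ≢ 1
    z≢1 refl with s≤s () ← 2+2t≤z

⌊z/2⌋*2 : ∀ z → 2 ≤ z → z / 2 * 2 ≡ suc (suc ((z / 2 ∸ 1) + (z / 2 ∸ 1)))
⌊z/2⌋*2 z 2≤z = begin
  z / 2 * 2                          ≡⟨ cong (_* 2) (m+[n∸m]≡n (m≥n⇒m/n>0 2≤z)) ⟨
  suc (z / 2 ∸ 1) * 2                ≡⟨ suc-*2 (z / 2 ∸ 1) ⟩
  suc (suc ((z / 2 ∸ 1) + (z / 2 ∸ 1))) ∎
  where
  open ≡-Reasoning
  suc-*2 : ∀ h → suc h * 2 ≡ suc (suc (h + h))
  suc-*2 = ℕ-Ring.solve-∀

split-by-half : ∀ z → 2 ≤ z → let t = z / 2 ∸ 1 in z ≡ suc (suc (t + t)) ⊎ z ≡ suc (suc (suc (t + t)))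
split-by-half z 2≤z with z % 2 | m%n<n z 2 | m≡m%n+[m/n]*n z 2
... | 0 | _ | z≡ = inj₁ (trans z≡ (⌊z/2⌋*2 z 2≤z))
... | 1 | _ | z≡ = inj₂ (trans z≡ (cong suc (⌊z/2⌋*2 z 2≤z)))
... | suc (suc _) | s≤s (s≤s ()) | _

lemma3p4 : (n : ℕ) {{_ : NonZero n}} → 2 ≤ n →
           (x : Config n) → Independent x →
           (i : ℤ) (j : Fin n) (z : ℕ) →
           ZeroBlock x (pos i j) z →
           (z ≡ 1 → Subslither x (pos i j) (E ∷ [])) ×
           (2 ≤ z → z ≤ n →
             Subslither x (pos i j) (D ∷ replicate (z / 2 ∸ 1) E ++ D ∷ []))
lemma3p4 (suc m) (s≤s 1≤m) x ix i j z block =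
    (λ z≡1 → z , block , (λ _ → refl) , (λ z≢1 → contradiction z≡1 z≢1))
  , (λ 2≤z _ → Slither.subslither m 1≤m x ix (pos i j) z block (z / 2 ∸ 1) (split-by-half z 2≤z))
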